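{- Let $G$ be a finite simple connected graph and $T$ its toll walk transit function. Then $T$ satisfies Axioms (JC) and (tr) on $G$ if and only if $G$ is a tree.
   Context: In a finite simple graph $G$, a walk $W=w_1w_2\cdots w_k$ ($k\ge 2$) is a toll walk if $w_1\neq w_k$, $w_2$ is the only neighbor of $w_1$ among the vertices of $W$, and $w_{k-1}$ is the only neighbor of $w_k$ among the vertices of $W$. The toll walk transit function $T$ of $G$ is given by $T(u,u)=\{u\}$ and, for $u\ne v$, $T(u,v)$ is the set of all vertices lying on some toll walk from $u$ to $v$. Axioms for $R=T$ on $V=V(G)$: (JC) For all pairwise distinct $u,x,y,v\in V$: if $x\in R(u,y)$, $y\in R(x,v)$ and $R(x,y)=\{x,y\}$, then $x\in R(u,v)$. (tr) For all $u,v,x\in V$ with $u\neq v$: if $R(u,x)=\{u,x\}$ and $R(x,v)=\{x,v\}$, then $x\in R(u,v)$. -}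

module Defs where

open import Data.Nat using (ℕ; _≤_)
open import Data.Fin using (Fin)
open import Data.List using (List; []; _∷_; _++_; [_]; length)
open import Data.List.Membership.Propositional using (_∈_)
open import Data.List.Relation.Unary.Linked using (Linked)
open import Data.List.Relation.Unary.Unique.Propositional using (Unique)
open import Data.Product using (Σ; ∃; _×_)
open import Data.Sum using (_⊎_)
open import Relation.Nullary using (¬_)
open import Relation.Binary using (Rel; Decidable)
open import Relation.Binary.PropositionalEquality using (_≡_; _≢_)
open import Level using (0ℓ)

record Graph (n : ℕ) : Set₁ where
  field
    E     : Rel (Fin n) 0ℓ
    E?    : Decidable E
    sym   : ∀ {x y} → E x y → E y x
    irrefl : ∀ x → ¬ E x x

module _ {n : ℕ} (G : Graph n) where
  open Graph G

  V : Set
  V = Fin n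

  -- A walk w₁ w₂ ⋯ w_k with k ≥ 2 is encoded by its first vertex u, its
  -- list of interior vertices xs and its last vertex v: the vertex sequence
  -- is  u ∷ xs ++ [ v ].
  walkList : V → List V → V → List V
  walkList u xs v = u ∷ (xs ++ [ v ])

  second : V → List V → V → V
  second u [] v = v
  second u (x ∷ xs) v = x

  penult : V → List V → V → V
  penult u [] v = u
  penult u (x ∷ xs) v = penult x xs v

  IsWalk : List V → Set
  IsWalk W = Linked E W

  TollWalk : V → List V → V → Set
  TollWalk u xs v =
    IsWalk (walkList u xs v) ×
    u ≢ v ×
    (∀ z → z ∈ walkList u xs v → E u z → z ≡ second u xs v) ×
    (∀ z → z ∈ walkList u xs v → E v z → z ≡ penult u xs v)

  T : V → V → V → Set
  T u v x = (u ≡ v × x ≡ u) ⊎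
            (u ≢ v × ∃ λ xs → TollWalk u xs v × x ∈ walkList u xs v)

  IsPair : (V → V → V → Set) → V → V → Set
  IsPair R x y = ∀ z → (R x y z → z ≡ x ⊎ z ≡ y) × (z ≡ x ⊎ z ≡ y → R x y z)

  JC : (V → V → V → Set) → Set
  JC R = ∀ u x y v → u ≢ x → u ≢ y → u ≢ v → x ≢ y → x ≢ v → y ≢ v →
         R u y x → R x v y → IsPair R x y → R u v x

  Tr : (V → V → V → Set) → Set
  Tr R = ∀ u v x → u ≢ v → IsPair R u x → IsPair R x v → R u v x

  Connected : Set
  Connected = ∀ u v → u ≡ v ⊎ ∃ λ xs → IsWalk (walkList u xs v)

  IsCycle : V → List V → V → Set
  IsCycle u xs v = 1 ≤ length xs × Unique (walkList u xs v) ×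
                   IsWalk (walkList u xs v) × E v u

  Acyclic : Set
  Acyclic = ∀ u xs v → ¬ IsCycle u xs v

  IsTree : Set
  IsTree = Connected × Acyclic

-- For a forest: if x ∈ T(u,y), y ∈ T(x,v) and xy is an edge, the toll walks must be u ⋯ x y and
-- x y ⋯ v, and their concatenation is again a toll walk. A neighbour z ≠ x of u on the second walk
-- would close a cycle: reduce the walk y ⋯ u and the walk x ⋯ z to non-backtracking walks, which in
-- a forest are paths, and glue them along the edge xy. Axiom (tr) holds because two edges ux, xv
-- form an induced path. Conversely, (tr) excludes triangles, and a shortest cycle u a b ⋯ v with at
-- least four vertices is chordless, so u a b and a b ⋯ v are toll walks and (JC) puts a into
-- T(u,v) = {u,v}.
module Submission where

open import Defs
open import Data.Nat using (ℕ; suc; _≤_; z≤n; s≤s)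
open import Data.Nat.Properties using (≤-refl; ≤-trans)
open import Data.Fin using (_≟_)
open import Data.List using (List; []; _∷_; _++_; [_]; length)
open import Data.List.Properties using (++-assoc; length-++-≤ˡ; length-++-≤ʳ; ∷-injectiveʳ)
open import Data.List.Membership.Propositional using (_∈_; _∉_)
open import Data.List.Membership.Propositional.Properties using (∈-++⁺ʳ; ∈-++⁻; ∈-∃++)
open import Data.List.Relation.Unary.Any using (here; there)
open import Data.List.Relation.Unary.All using ([]; _∷_; tabulate) renaming (lookup to All-lookup)
import Data.List.Relation.Unary.All.Properties as All
open import Data.List.Relation.Unary.AllPairs using ([]; _∷_)
open import Data.List.Relation.Unary.Linked as Linked using (Linked; []; [-]; _∷_)
open import Data.List.Relation.Unary.Unique.Propositional using (Unique)
open import Data.Product using (∃; ∃₂; _×_; _,_; proj₁; proj₂)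
open import Data.Sum as Sum using (_⊎_; inj₁; inj₂; [_,_]′)
open import Data.Empty using (⊥; ⊥-elim)
open import Data.Unit using (⊤; tt)
open import Relation.Nullary using (¬_; yes; no)
open import Relation.Binary.PropositionalEquality using (_≡_; _≢_; refl; sym; trans; cong; subst)
open import Function.Bundles using (_⇔_; mk⇔)

module _ {A : Set} where

  Linked-++⁻ˡ : ∀ {R : A → A → Set} xs {ys} → Linked R (xs ++ ys) → Linked R xs
  Linked-++⁻ˡ []           _        = []
  Linked-++⁻ˡ (x ∷ [])     _        = [-]
  Linked-++⁻ˡ (x ∷ y ∷ xs) (r ∷ rs) = r ∷ Linked-++⁻ˡ (y ∷ xs) rs

  Linked-++⁻ʳ : ∀ {R : A → A → Set} xs {ys} → Linked R (xs ++ ys) → Linked R ys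
  Linked-++⁻ʳ []       rs = rs
  Linked-++⁻ʳ (x ∷ xs) rs = Linked-++⁻ʳ xs (Linked.tail rs)

  Unique-++⁻ˡ : ∀ xs {ys : List A} → Unique (xs ++ ys) → Unique xs
  Unique-++⁻ˡ []       _         = []
  Unique-++⁻ˡ (x ∷ xs) (x∉ ∷ us) = All.++⁻ˡ xs x∉ ∷ Unique-++⁻ˡ xs us

  Unique-++⁻ʳ : ∀ xs {ys : List A} → Unique (xs ++ ys) → Unique ys
  Unique-++⁻ʳ []       us       = us
  Unique-++⁻ʳ (x ∷ xs) (_ ∷ us) = Unique-++⁻ʳ xs us

  Unique-head-≢ : ∀ {x y : A} {xs} → Unique (x ∷ xs) → y ∈ xs → x ≢ y
  Unique-head-≢ (x∉ ∷ _) = All-lookup x∉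

module TollWalks {n : ℕ} (G : Graph n) where
  open Graph G renaming (sym to E-sym)

  private variable
    a b c p q u v w x y z : V G
    xs ys : List (V G)
    S S′ : V G → Set

  OnlyNeighbour : V G → (V G → Set) → V G → Set
  OnlyNeighbour c S d = ∀ z → S z → E c z → z ≡ d

  E⇒≢ : E a b → a ≢ b
  E⇒≢ e refl = irrefl _ e

  last-∈ : ∀ u xs v → v ∈ walkList G u xs v
  last-∈ u xs v = there (∈-++⁺ʳ xs (here refl))

  second-∈ : ∀ u xs v → second G u xs v ∈ walkList G u xs v
  second-∈ u []       v = there (here refl)
  second-∈ u (x ∷ xs) v = there (here refl)

  second-adjacent : ∀ u xs v → Linked E (walkList G u xs v) → E u (second G u xs v)
  second-adjacent u []       v (e ∷ _) = e
  second-adjacent u (x ∷ xs) v (e ∷ _) = e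

  penult-∈ : ∀ u xs v → penult G u xs v ∈ walkList G u xs v
  penult-∈ u []       v = here refl
  penult-∈ u (x ∷ xs) v = there (penult-∈ x xs v)

  penult-adjacent : ∀ u xs v → Linked E (walkList G u xs v) → E (penult G u xs v) v
  penult-adjacent u []       v (e ∷ _)  = e
  penult-adjacent u (x ∷ xs) v (_ ∷ es) = penult-adjacent x xs v es

  penult-∷ʳ : ∀ {u xs} ys z v → u ∷ xs ≡ ys ++ [ z ] → penult G u xs v ≡ z
  penult-∷ʳ []                 z v refl = refl
  penult-∷ʳ (y ∷ [])           z v refl = refl
  penult-∷ʳ {xs = x ∷ xs} (y ∷ y′ ∷ ys) z v eq = penult-∷ʳ (y′ ∷ ys) z v (∷-injectiveʳ eq)

  edge-tollWalk : E p q → TollWalk G p [] q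
  edge-tollWalk {p} {q} e = e ∷ [-] , E⇒≢ e , only-p , only-q
    where
      only-p : OnlyNeighbour p (_∈ walkList G p [] q) q
      only-p z (here refl)         e′ = ⊥-elim (irrefl _ e′)
      only-p z (there (here refl)) e′ = refl
      only-q : OnlyNeighbour q (_∈ walkList G p [] q) p
      only-q z (here refl)         e′ = refl
      only-q z (there (here refl)) e′ = ⊥-elim (irrefl _ e′)

  induced-path₃-tollWalk : E a b → E b c → ¬ E a c → a ≢ c → TollWalk G a [ b ] c
  induced-path₃-tollWalk {a} {b} {c} eab ebc ¬eac a≢c = eab ∷ ebc ∷ [-] , a≢c , only-a , only-c
    where
      only-a : OnlyNeighbour a (_∈ walkList G a [ b ] c) b
      only-a z (here refl)                 e = ⊥-elim (irrefl _ e)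
      only-a z (there (here refl))         e = refl
      only-a z (there (there (here refl))) e = ⊥-elim (¬eac e)
      only-c : OnlyNeighbour c (_∈ walkList G a [ b ] c) b
      only-c z (here refl)                 e = ⊥-elim (¬eac (E-sym e))
      only-c z (there (here refl))         e = refl
      only-c z (there (there (here refl))) e = ⊥-elim (irrefl _ e)

  data Reach (S : V G → Set) (a : V G) : V G → Set where
    ε    : Reach S a a
    step : ∀ {b c} → Reach S a b → E b c → S c → Reach S a c

  Reach-target : S a → Reach S a b → S b
  Reach-target sa ε             = sa
  Reach-target sa (step _ _ sc) = sc

  Reach-mono : (∀ {z} → S z → S′ z) → Reach S a b → Reach S′ a b
  Reach-mono f ε             = ε
  Reach-mono f (step r e sc) = step (Reach-mono f r) e (f sc)

  Reach-trans : Reach S a b → Reach S b c → Reach S a c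
  Reach-trans r ε              = r
  Reach-trans r (step r′ e sc) = step (Reach-trans r r′) e sc

  Reach-sym : S a → Reach S a b → Reach S b a
  Reach-sym sa ε            = ε
  Reach-sym sa (step r e _) = Reach-trans (step ε (E-sym e) (Reach-target sa r)) (Reach-sym sa r)

  walk-Reach : Linked E (a ∷ xs) → w ∈ a ∷ xs → Reach (_∈ a ∷ xs) a w
  walk-Reach _        (here refl) = ε
  walk-Reach (e ∷ es) (there w∈)  =
    Reach-trans (step ε e (there (here refl))) (Reach-mono there (walk-Reach es w∈))

  walk-connects : Linked E (w ∷ xs) → a ∈ w ∷ xs → b ∈ w ∷ xs → Reach (_∈ w ∷ xs) a b
  walk-connects es a∈ b∈ = Reach-trans (Reach-sym (here refl) (walk-Reach es a∈)) (walk-Reach es b∈)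

  adjacent-tollWalk-vertices : E p q → TollWalk G p xs q → w ∈ walkList G p xs q → w ≡ p ⊎ w ≡ q
  adjacent-tollWalk-vertices {p} {q} {xs} e (es , _ , only-p , only-q) w∈ = go (walk-Reach es w∈)
    where
      go : Reach (_∈ walkList G p xs q) p w → w ≡ p ⊎ w ≡ q
      go ε = inj₁ refl
      go (step r e′ c∈) with go r
      ... | inj₁ refl = inj₂ (trans (only-p _ c∈ e′) (sym (only-p q (last-∈ p xs q) e)))
      ... | inj₂ refl = inj₁ (trans (only-q _ c∈ e′) (sym (only-q p (here refl) (E-sym e))))

  edge⇒IsPair : E p q → IsPair G (T G) p q
  edge⇒IsPair {p} {q} e z = from-T , to-T
    where
      from-T : T G p q z → z ≡ p ⊎ z ≡ q
      from-T (inj₁ (_ , z≡p))          = inj₁ z≡p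
      from-T (inj₂ (_ , _ , toll , z∈)) = adjacent-tollWalk-vertices e toll z∈
      to-T : z ≡ p ⊎ z ≡ q → T G p q z
      to-T (inj₁ refl) = inj₂ (E⇒≢ e , [] , edge-tollWalk e , here refl)
      to-T (inj₂ refl) = inj₂ (E⇒≢ e , [] , edge-tollWalk e , there (here refl))

  IsPair⇒edge : p ≢ q → IsPair G (T G) p q → E p q
  IsPair⇒edge {p} {q} p≢q pair with proj₂ (pair q) (inj₂ refl)
  ... | inj₁ (p≡q , _) = ⊥-elim (p≢q p≡q)
  ... | inj₂ (_ , xs , toll@(es , _) , _)
    with proj₁ (pair (second G p xs q)) (inj₂ (p≢q , xs , toll , second-∈ p xs q))
  ...   | inj₁ s≡p = ⊥-elim (E⇒≢ (second-adjacent p xs q es) (sym s≡p))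
  ...   | inj₂ s≡q = subst (E p) s≡q (second-adjacent p xs q es)

  NonBacktracking : List (V G) → Set
  NonBacktracking (a ∷ b ∷ c ∷ xs) = a ≢ c × NonBacktracking (b ∷ c ∷ xs)
  NonBacktracking _                = ⊤

  NonBacktracking-tail : ∀ xs → NonBacktracking (a ∷ xs) → NonBacktracking xs
  NonBacktracking-tail []           _        = tt
  NonBacktracking-tail (b ∷ [])     _        = tt
  NonBacktracking-tail (b ∷ c ∷ xs) (_ , nb) = nb

  record NBWalk (S : V G → Set) (w a : V G) : Set where
    constructor nbWalk
    field
      interior        : List (V G)
      linked          : Linked E (walkList G w interior a)
      nonBacktracking : NonBacktracking (walkList G w interior a)
      inside          : ∀ z → z ∈ walkList G w interior a → S z

  private
    inside-∷ : S c → (∀ z → z ∈ xs → S z) → ∀ z → z ∈ c ∷ xs → S z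
    inside-∷ sc _ z (here refl) = sc
    inside-∷ _  f z (there z∈)  = f z z∈

  -- The reduced walk runs from the current vertex back to the origin, so a step pushes at the
  -- front, or pops when it backtracks.
  NBWalk-step : S a → b ≡ a ⊎ NBWalk S b a → E b c → S c → c ≡ a ⊎ NBWalk S c a
  NBWalk-step sa (inj₁ refl) e sc =
    inj₂ (nbWalk [] (E-sym e ∷ [-]) tt (inside-∷ sc (inside-∷ sa (λ _ ()))))
  NBWalk-step {a = a} {c = c} sa (inj₂ (nbWalk [] es nb ins)) e sc with c ≟ a
  ... | yes c≡a = inj₁ c≡a
  ... | no  c≢a = inj₂ (nbWalk [ _ ] (E-sym e ∷ es) (c≢a , tt) (inside-∷ sc ins))
  NBWalk-step {c = c} sa (inj₂ (nbWalk (p ∷ xs) es nb ins)) e sc with c ≟ p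
  ... | yes refl = inj₂ (nbWalk xs (Linked.tail es) (NonBacktracking-tail (p ∷ xs ++ _) nb) (λ z z∈ → ins z (there z∈)))
  ... | no  c≢p  = inj₂ (nbWalk (_ ∷ p ∷ xs) (E-sym e ∷ es) (c≢p , nb) (inside-∷ sc ins))

  Reach⇒NBWalk : S a → Reach S a w → w ≡ a ⊎ NBWalk S w a
  Reach⇒NBWalk sa ε             = inj₁ refl
  Reach⇒NBWalk sa (step r e sc) = NBWalk-step sa (Reach⇒NBWalk sa r) e sc

  Linked-concat : ∀ u xs {y} ys {v} → Linked E (walkList G u xs y) → penult G u xs y ≡ x →
                  Linked E (walkList G x ys v) → Linked E (walkList G u (xs ++ ys) v)
  Linked-concat u []       ys _        refl es′ = es′
  Linked-concat u (p ∷ xs) ys (e ∷ es) eq   es′ = e ∷ Linked-concat p xs ys es eq es′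

  NonBacktracking-glue : ∀ u xs {y} ys {v} → NonBacktracking (walkList G u xs y) → penult G u xs y ≡ x →
                         NonBacktracking (walkList G x (y ∷ ys) v) →
                         NonBacktracking (walkList G u (xs ++ y ∷ ys) v)
  NonBacktracking-glue u []           ys _         refl nb′ = nb′
  NonBacktracking-glue u (p ∷ [])     ys (u≢y , _) eq   nb′ = u≢y , NonBacktracking-glue p [] ys tt eq nb′
  NonBacktracking-glue u (p ∷ q ∷ xs) ys (u≢q , nb) eq  nb′ = u≢q , NonBacktracking-glue p (q ∷ xs) ys nb eq nb′

  walkList-concat-∈⁻ : ∀ u xs {y} ys {v} → penult G u xs y ≡ x → z ∈ walkList G u (xs ++ ys) v →
                       z ∈ walkList G u xs y ⊎ z ∈ walkList G x ys v
  walkList-concat-∈⁻ u []       ys refl z∈          = inj₂ z∈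
  walkList-concat-∈⁻ u (p ∷ xs) ys eq   (here refl) = inj₁ (here refl)
  walkList-concat-∈⁻ u (p ∷ xs) ys eq   (there z∈)  = Sum.map₁ there (walkList-concat-∈⁻ p xs ys eq z∈)

  penult-∈-concat : ∀ u xs y ys v → penult G u xs y ∈ walkList G u (xs ++ ys) v
  penult-∈-concat u []       y ys v = here refl
  penult-∈-concat u (p ∷ xs) y ys v = there (penult-∈-concat p xs y ys v)

  penult-concat : ∀ u xs y ys v → penult G u xs y ≡ x → penult G u (xs ++ ys) v ≡ penult G x ys v
  penult-concat u []       y ys v refl = refl
  penult-concat u (p ∷ xs) y ys v eq   = penult-concat p xs y ys v eq

  triangle-IsCycle : E a b → E b c → E c a → IsCycle G a [ b ] c
  triangle-IsCycle eab ebc eca =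
    s≤s z≤n , (E⇒≢ eab ∷ (λ a≡c → E⇒≢ eca (sym a≡c)) ∷ []) ∷ (E⇒≢ ebc ∷ []) ∷ [] ∷ [] ,
    eab ∷ ebc ∷ [-] , eca

  module _ (acyclic : Acyclic G) where

    NonBacktracking-no-return : ∀ xs → Linked E (a ∷ xs) → NonBacktracking (a ∷ xs) → Unique xs → a ∉ xs
    NonBacktracking-no-return {a} xs es nb us a∈ with ∈-∃++ a∈
    ... | []        , q , refl = irrefl a (Linked.head es)
    ... | b ∷ []    , q , refl = proj₁ nb refl
    ... | b ∷ c ∷ p , q , refl =
      acyclic b (c ∷ p) a (s≤s z≤n , Unique-++⁻ˡ cycle (subst Unique split us) ,
                           Linked-++⁻ˡ cycle (subst (Linked E) split (Linked.tail es)) , Linked.head es)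
      where
        cycle = walkList G b (c ∷ p) a
        split : b ∷ c ∷ p ++ a ∷ q ≡ cycle ++ q
        split = cong (λ t → b ∷ c ∷ t) (sym (++-assoc p [ a ] q))

    NonBacktracking⇒Unique : ∀ xs → Linked E xs → NonBacktracking xs → Unique xs
    NonBacktracking⇒Unique []       _  _  = []
    NonBacktracking⇒Unique (a ∷ xs) es nb =
      tabulate (λ b∈ a≡b → NonBacktracking-no-return xs es nb us (subst (_∈ xs) (sym a≡b) b∈)) ∷ us
      where us = NonBacktracking⇒Unique xs (Linked.tail es) (NonBacktracking-tail xs nb)

    NonBacktracking-no-closing-edge : ∀ a xs b → Linked E (walkList G a xs b) →
                                      NonBacktracking (walkList G a xs b) → 1 ≤ length xs → ¬ E b a
    NonBacktracking-no-closing-edge a xs b es nb len e =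
      acyclic a xs b (len , NonBacktracking⇒Unique _ es nb , es , e)

    -- The two reductions glue along the edge y x into a non-backtracking walk z ⋯ y x ⋯ u.
    onlyNeighbour-across-edge : u ≢ y → u ≢ x → S u → Reach S u y → OnlyNeighbour y S x →
                                S′ x → Reach S′ x z → OnlyNeighbour x S′ y → E u z → z ≡ x
    onlyNeighbour-across-edge {u} {y} {x} {z = z} u≢y u≢x su r only-y sx r′ only-x euz
      with Reach⇒NBWalk su r
    ... | inj₁ y≡u                 = ⊥-elim (u≢y (sym y≡u))
    ... | inj₂ (nbWalk [] es _ ins) = ⊥-elim (u≢x (only-y u (ins u (there (here refl))) (Linked.head es)))
    ... | inj₂ (nbWalk (t ∷ ts) es nb ins)
      with only-y t (ins t (there (here refl))) (Linked.head es)
    ...   | refl with Reach⇒NBWalk sx r′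
    ...     | inj₁ z≡x = z≡x
    ...     | inj₂ (nbWalk zs es′ nb′ ins′) =
      ⊥-elim (NonBacktracking-no-closing-edge z (zs ++ x ∷ ts) u
                (Linked-concat z zs (x ∷ ts) es′ pen es) (NonBacktracking-glue z zs ts nb′ pen nb)
                (≤-trans (s≤s z≤n) (length-++-≤ʳ (x ∷ ts) {zs})) euz)
      where
        pen : penult G z zs x ≡ y
        pen = only-x _ (ins′ _ (penult-∈ z zs x)) (E-sym (penult-adjacent z zs x es′))

    tollWalk-concat : u ≢ v → u ≢ x → v ≢ y →
                      TollWalk G u xs y → penult G u xs y ≡ x →
                      TollWalk G x ys v → second G x ys v ≡ y →
                      TollWalk G u (xs ++ ys) v
    tollWalk-concat {xs = []} _ u≢x _ _ pen _ _ = ⊥-elim (u≢x pen)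
    tollWalk-concat {u} {v} {x} {y} {p ∷ xs} {ys} u≢v u≢x v≢y
                    (es₁ , u≢y , only-u₁ , only-y₁) pen (es₂ , x≢v , only-x₂ , only-v₂) sec =
      Linked-concat u (p ∷ xs) ys es₁ pen es₂ , u≢v , only-u ,
      λ z z∈ e → trans (only-v z z∈ e) (sym (penult-concat u (p ∷ xs) y ys v pen))
      where
        W₁ = walkList G u (p ∷ xs) y
        W₂ = walkList G x ys v
        y-only : OnlyNeighbour y (_∈ W₁) x
        y-only z z∈ e = trans (only-y₁ z z∈ e) pen
        x-only : OnlyNeighbour x (_∈ W₂) y
        x-only z z∈ e = trans (only-x₂ z z∈ e) sec
        x∈W₁ : x ∈ W₁
        x∈W₁ = subst (_∈ W₁) pen (penult-∈ u (p ∷ xs) y)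
        y∈W₂ : y ∈ W₂
        y∈W₂ = subst (_∈ W₂) sec (second-∈ x ys v)
        only-u : OnlyNeighbour u (_∈ walkList G u (p ∷ xs ++ ys) v) p
        only-u z z∈ e with walkList-concat-∈⁻ u (p ∷ xs) ys pen z∈
        ... | inj₁ z∈₁ = only-u₁ z z∈₁ e
        ... | inj₂ z∈₂ = trans z≡x (only-u₁ x x∈W₁ (subst (E u) z≡x e))
          where
            z≡x = onlyNeighbour-across-edge u≢y u≢x (here refl) (walk-Reach es₁ (last-∈ u (p ∷ xs) y)) y-only
                                            (here refl) (walk-Reach es₂ z∈₂) x-only e
        only-v : OnlyNeighbour v (_∈ walkList G u (p ∷ xs ++ ys) v) (penult G x ys v)
        only-v z z∈ e with walkList-concat-∈⁻ u (p ∷ xs) ys pen z∈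
        ... | inj₂ z∈₂ = only-v₂ z z∈₂ e
        ... | inj₁ z∈₁ = trans z≡y (only-v₂ y y∈W₂ (subst (E v) z≡y e))
          where
            z≡y = onlyNeighbour-across-edge (λ v≡x → x≢v (sym v≡x)) v≢y
                    (last-∈ x ys v) (walk-connects es₂ (last-∈ x ys v) (here refl)) x-only
                    (last-∈ u (p ∷ xs) y) (walk-connects es₁ (last-∈ u (p ∷ xs) y) z∈₁) y-only e

    forest-JC : JC G (T G)
    forest-JC u x y v _ u≢y _ _ _ _ (inj₁ (u≡y , _)) _ _ = ⊥-elim (u≢y u≡y)
    forest-JC u x y v _ _ _ _ x≢v _ _ (inj₁ (x≡v , _)) _ = ⊥-elim (x≢v x≡v)
    forest-JC u x y v u≢x _ u≢v x≢y _ y≢v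
              (inj₂ (_ , xs , toll₁@(_ , _ , _ , only-y) , x∈)) (inj₂ (_ , ys , toll₂@(_ , _ , only-x , _) , y∈)) xy-pair =
      inj₂ (u≢v , xs ++ ys , tollWalk-concat u≢v u≢x (λ v≡y → y≢v (sym v≡y)) toll₁ pen toll₂ sec ,
            subst (_∈ walkList G u (xs ++ ys) v) pen (penult-∈-concat u xs y ys v))
      where
        exy = IsPair⇒edge x≢y xy-pair
        pen : penult G u xs y ≡ x
        pen = sym (only-y x x∈ (E-sym exy))
        sec : second G x ys v ≡ y
        sec = sym (only-x y y∈ exy)

    forest-Tr : Tr G (T G)
    forest-Tr u v x u≢v ux-pair xv-pair with x ≟ u | x ≟ v
    ... | yes refl | _        = proj₂ (xv-pair x) (inj₁ refl)
    ... | no _     | yes refl = proj₂ (ux-pair x) (inj₂ refl)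
    ... | no x≢u   | no x≢v   = path₃-∈-T (IsPair⇒edge (λ u≡x → x≢u (sym u≡x)) ux-pair) (IsPair⇒edge x≢v xv-pair)
      where
        path₃-∈-T : E u x → E x v → T G u v x
        path₃-∈-T eux exv with E? u v
        ... | yes euv = ⊥-elim (acyclic u [ x ] v (triangle-IsCycle eux exv (E-sym euv)))
        ... | no ¬euv = inj₂ (u≢v , [ x ] , induced-path₃-tollWalk eux exv ¬euv u≢v , there (here refl))

  Tr⇒no-triangle : Tr G (T G) → E a b → E b c → E c a → ⊥
  Tr⇒no-triangle {a} {b} {c} tr eab ebc eca =
    [ (λ b≡a → E⇒≢ eab (sym b≡a)) , E⇒≢ ebc ]′ (proj₁ (edge⇒IsPair (E-sym eca) b) b∈T)
    where
      b∈T : T G a c b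
      b∈T = tr a c b (λ a≡c → E⇒≢ eca (sym a≡c)) (edge⇒IsPair eab) (edge⇒IsPair ebc)

  onlyNeighbour? : ∀ c d xs → OnlyNeighbour c (_∈ xs) d ⊎ ∃ λ z → z ∈ xs × E c z × z ≢ d
  onlyNeighbour? c d []       = inj₁ (λ _ ())
  onlyNeighbour? c d (w ∷ xs) with E? c w | w ≟ d | onlyNeighbour? c d xs
  ... | yes ecw | no w≢d | _                      = inj₂ (w , here refl , ecw , w≢d)
  ... | _       | _      | inj₂ (z , z∈ , e , z≢d) = inj₂ (z , there z∈ , e , z≢d)
  ... | no ¬ecw | _      | inj₁ only = inj₁ λ { z (here refl) e → ⊥-elim (¬ecw e) ; z (there z∈) e → only z z∈ e }
  ... | yes _   | yes w≡d | inj₁ only = inj₁ λ { z (here refl) _ → w≡d ; z (there z∈) e → only z z∈ e }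

  CycleOfSize≤ : ℕ → Set
  CycleOfSize≤ k = ∃₂ λ u xs → ∃ λ v → IsCycle G u xs v × length (walkList G u xs v) ≤ k

  CycleOfSize≤-weaken : ∀ {m k} → m ≤ k → CycleOfSize≤ m → CycleOfSize≤ k
  CycleOfSize≤-weaken m≤k (u , xs , v , cyc , size) = u , xs , v , cyc , ≤-trans size m≤k

  chord-at-start⇒cycle : ∀ a b ys → Unique (a ∷ b ∷ ys) → Linked E (a ∷ b ∷ ys) → z ∈ ys → E a z →
                         CycleOfSize≤ (length (a ∷ b ∷ ys))
  chord-at-start⇒cycle {z} a b ys us es z∈ eaz with ∈-∃++ z∈
  ... | p , q , refl =
    a , b ∷ p , z ,
    (s≤s z≤n , Unique-++⁻ˡ cycle (subst Unique split us) , Linked-++⁻ˡ cycle (subst (Linked E) split es) , E-sym eaz) ,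
    subst (length cycle ≤_) (cong length (sym split)) (length-++-≤ˡ cycle)
    where
      cycle = walkList G a (b ∷ p) z
      split : a ∷ b ∷ p ++ z ∷ q ≡ cycle ++ q
      split = cong (λ t → a ∷ b ∷ t) (sym (++-assoc p [ z ] q))

  chord-at-end⇒cycle : ∀ a ys v → Unique (walkList G a ys v) → Linked E (walkList G a ys v) →
                       z ∈ a ∷ ys → z ≢ penult G a ys v → E v z → CycleOfSize≤ (length (walkList G a ys v))
  chord-at-end⇒cycle {z} a ys v us es z∈ z≢pen evz with ∈-∃++ z∈
  ... | p , []    , eq = ⊥-elim (z≢pen (sym (penult-∷ʳ p z v eq)))
  ... | p , c ∷ q , eq =
    z , c ∷ q , v ,
    (s≤s z≤n , Unique-++⁻ʳ p (subst Unique split us) , Linked-++⁻ʳ p (subst (Linked E) split es) , evz) ,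
    subst (length cycle ≤_) (cong length (sym split)) (length-++-≤ʳ cycle {p})
    where
      cycle = walkList G z (c ∷ q) v
      split : walkList G a ys v ≡ p ++ cycle
      split = trans (cong (_++ [ v ]) eq) (++-assoc p (z ∷ c ∷ q) [ v ])

  JC-forbids-chordless-cycle :
    JC G (T G) → ∀ u a b rest v →
    Unique (walkList G u (a ∷ b ∷ rest) v) → Linked E (walkList G u (a ∷ b ∷ rest) v) → E v u → ¬ E u b →
    OnlyNeighbour a (_∈ walkList G a (b ∷ rest) v) b →
    OnlyNeighbour v (_∈ walkList G a (b ∷ rest) v) (penult G a (b ∷ rest) v) → ⊥
  JC-forbids-chordless-cycle jc u a b rest v us@(_ ∷ us′@(_ ∷ us″)) (eua ∷ es) evu ¬eub only-a only-v =
    [ (λ a≡u → u≢a (sym a≡u)) , a≢v ]′ (proj₁ (edge⇒IsPair (E-sym evu) a) a∈T)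
    where
      v∈ : v ∈ rest ++ [ v ]
      v∈ = ∈-++⁺ʳ rest (here refl)
      u≢a = Unique-head-≢ us (here refl)
      u≢b = Unique-head-≢ us (there (here refl))
      u≢v = Unique-head-≢ us (there (there v∈))
      a≢b = Unique-head-≢ us′ (here refl)
      a≢v = Unique-head-≢ us′ (there v∈)
      b≢v = Unique-head-≢ us″ v∈
      a∈T : T G u v a
      a∈T = jc u a b v u≢a u≢b u≢v a≢b a≢v b≢v
              (inj₂ (u≢b , [ a ] , induced-path₃-tollWalk eua (Linked.head es) ¬eub u≢b , there (here refl)))
              (inj₂ (a≢v , b ∷ rest , (es , a≢v , only-a , only-v) , there (here refl)))
              (edge⇒IsPair (Linked.head es))

  module _ (jc : JC G (T G)) (tr : Tr G (T G)) where

    no-cycle : ∀ k → ¬ CycleOfSize≤ k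
    no-cycle (suc k) (u , a ∷ [] , v , (_ , _ , eua ∷ eav ∷ [-] , evu) , _) = Tr⇒no-triangle tr eua eav evu
    no-cycle (suc k) (u , a ∷ b ∷ rest , v , (_ , us@(_ ∷ us′) , es@(eua ∷ es′) , evu) , s≤s size)
      with E? u b | onlyNeighbour? a b (walkList G a (b ∷ rest) v)
                  | onlyNeighbour? v (penult G a (b ∷ rest) v) (walkList G a (b ∷ rest) v)
    ... | yes eub | _ | _ = Tr⇒no-triangle tr eua (Linked.head es′) (E-sym eub)
    ... | no _ | inj₂ (z , here refl , eaz , _) | _ = irrefl _ eaz
    ... | no _ | inj₂ (z , there (here refl) , _ , z≢b) | _ = z≢b refl
    ... | no _ | inj₂ (z , there (there z∈) , eaz , _) | _ =
      no-cycle k (CycleOfSize≤-weaken size (chord-at-start⇒cycle a b (rest ++ [ v ]) us′ es′ z∈ eaz))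
    ... | no ¬eub | inj₁ only-a | inj₁ only-v = JC-forbids-chordless-cycle jc u a b rest v us es evu ¬eub only-a only-v
    ... | no _ | inj₁ _ | inj₂ (z , z∈ , evz , z≢pen) with ∈-++⁻ (a ∷ b ∷ rest) z∈
    ...   | inj₂ (here refl) = irrefl _ evz
    ...   | inj₁ z∈′ = no-cycle k (CycleOfSize≤-weaken size (chord-at-end⇒cycle a (b ∷ rest) v us′ es′ z∈′ z≢pen evz))

    JC∧Tr⇒Acyclic : Acyclic G
    JC∧Tr⇒Acyclic u xs v cyc = no-cycle _ (u , xs , v , cyc , ≤-refl)

theorem6 : {n : ℕ} (G : Graph n) → Connected G →
           ((JC G (T G) × Tr G (T G)) ⇔ IsTree G)
theorem6 G connected = mk⇔
  (λ (jc , tr) → connected , JC∧Tr⇒Acyclic jc tr)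
  (λ (_ , acyclic) → forest-JC acyclic , forest-Tr acyclic)
  where open TollWalks G
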